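{- For a partition $\alpha=(\alpha_1,\dots,\alpha_t)$ of $n$ let $s(\alpha)=\sum_{i=1}^t\alpha_i^2$, and let $\alpha^*$ be the conjugate partition. Then \[ s(\alpha)+s(\alpha^*)=2\sum_{k\ge1}k\,d_k(\alpha), \] where $\delta(\alpha)=(d_k(\alpha))_{k\ge1}$ (only finitely many terms are nonzero; $d_k=0$ for $k\ge t+\alpha_1$). Consequently, if $\alpha,\beta\in\mathcal{P}(n)$ satisfy $\delta(\alpha)=\delta(\beta)$, then $s(\alpha)+s(\alpha^*)=s(\beta)+s(\beta^*)$.
   Context: $\mathcal{P}(n)$ is the set of partitions $\alpha=(\alpha_1\ge\dots\ge\alpha_t\ge1)$ of $n$, with $\alpha_i=0$ for $i>t$. The diagonal sequence is $\delta(\alpha)=(d_k(\alpha))_{k\ge1}$ with $d_k(\alpha)=\big|\{i:1\le i\le k,\ \alpha_i+i-1\ge k\}\big|$. -}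

module Defs where

open import Data.Nat using (ℕ; zero; suc; _+_; _*_; _∸_; _≤_; _≥_; _≤?_)
open import Data.List using (List; []; _∷_; length; map; filter; applyUpTo)
open import Data.Nat.ListAction using (sum)
open import Data.List.Relation.Unary.All using (All)
open import Data.List.Relation.Unary.Linked using (Linked)
open import Relation.Binary.PropositionalEquality using (_≡_)
open import Data.Product using (_×_)

IsPartition : ℕ → List ℕ → Set
IsPartition n α = Linked _≥_ α × All (1 ≤_) α × sum α ≡ n

-- α_i, 1-indexed, with α_i = 0 for i > t (and, by convention, for i = 0).
part : List ℕ → ℕ → ℕ
part []       _             = 0
part (x ∷ xs) zero          = 0
part (x ∷ xs) (suc zero)    = x
part (x ∷ xs) (suc (suc i)) = part xs (suc i)

first : List ℕ → ℕ
first α = part α 1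

oneTo : ℕ → List ℕ
oneTo m = applyUpTo suc m

countGe : ℕ → List ℕ → ℕ
countGe j α = length (filter (j ≤?_) α)

conj : List ℕ → List ℕ
conj α = map (λ j → countGe j α) (oneTo (first α))

s : List ℕ → ℕ
s α = sum (map (λ a → a * a) α)

d : List ℕ → ℕ → ℕ
d α k = length (filter (λ i → k ≤? part α i + i ∸ 1) (oneTo k))

weightedDiagSum : List ℕ → ℕ → ℕ
weightedDiagSum α N = sum (map (λ k → k * d α k) (oneTo N))

-- Both sides satisfy the same recursion in the first part a of α = a ∷ β.
-- For j ≤ a the conjugate has α*_j = 1 + β*_j, so s(α*) = a + 2|β| + s(β*).
-- Deleting the first row shifts the diagonals, d_{k+1}(α) = [k < a] + d_k(β),
-- and Σ_k d_k(β) = |β| since every cell lies on exactly one diagonal; hence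
-- 2 Σ_k k d_k also grows by a² + a + 2|β|.
module Submission where

open import Defs
open import Data.Nat using (ℕ; _+_; _*_; _≤_)
open import Data.List using (List; length)
open import Data.Product using (_×_)
open import Relation.Binary.PropositionalEquality using (_≡_)

open import Data.Bool using (true; false; if_then_else_)
open import Data.Nat using (zero; suc; _<_; _∸_; _≥_; _≤?_; z≤n; s≤s; s≤s⁻¹)
open import Data.Nat.Properties
  using ( ≤-refl; ≤-trans; ≤⇒≯; <⇒≱; m≤m+n; m≤n+m; m+n≤o⇒n≤o; +-monoʳ-≤
        ; +-suc; +-identityʳ; *-zeroʳ; *-distribˡ-+; +-commutativeSemigroup)
open import Data.Nat.ListAction using (sum)
open import Data.Nat.Tactic.RingSolver using (solve-∀)
open import Algebra.Properties.CommutativeSemigroup +-commutativeSemigroup using (interchange)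
open import Data.List using ([]; _∷_; map; filter; applyUpTo)
open import Data.List.Properties using (map-applyUpTo)
open import Data.List.Relation.Unary.All using (All; []; _∷_)
open import Data.List.Relation.Unary.Linked using (Linked; _∷_; tail)
open import Data.List.Relation.Unary.Linked.Properties using (Linked⇒All)
open import Data.Product using (_,_)
open import Function using (_∘_; mk⇔)
open import Relation.Nullary using (Dec; does; ¬_)
open import Relation.Nullary.Decidable using (dec-true; dec-false; does-⇔)
open import Relation.Unary using (Pred; Decidable)
open import Relation.Binary.PropositionalEquality using (refl; sym; trans; cong; cong₂; module ≡-Reasoning)

open ≡-Reasoning

∑< : ℕ → (ℕ → ℕ) → ℕ
∑< m f = sum (applyUpTo f m)

syntax ∑< m (λ i → e) = ∑[ i < m ] e

∑<-cong : ∀ m {f g : ℕ → ℕ} → (∀ i → i < m → f i ≡ g i) → ∑< m f ≡ ∑< m g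
∑<-cong zero    f≡g = refl
∑<-cong (suc m) f≡g = cong₂ _+_ (f≡g 0 (s≤s z≤n)) (∑<-cong m (λ i i<m → f≡g (suc i) (s≤s i<m)))

∑<-zero : ∀ m {f : ℕ → ℕ} → (∀ i → i < m → f i ≡ 0) → ∑< m f ≡ 0
∑<-zero zero    f≡0 = refl
∑<-zero (suc m) f≡0 = cong₂ _+_ (f≡0 0 (s≤s z≤n)) (∑<-zero m (λ i i<m → f≡0 (suc i) (s≤s i<m)))

∑<-distrib-+ : ∀ m (f g : ℕ → ℕ) → ∑[ i < m ] (f i + g i) ≡ ∑< m f + ∑< m g
∑<-distrib-+ zero    f g = refl
∑<-distrib-+ (suc m) f g = trans (cong (f 0 + g 0 +_) (∑<-distrib-+ m (f ∘ suc) (g ∘ suc)))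
                                 (interchange (f 0) (g 0) (∑< m (f ∘ suc)) (∑< m (g ∘ suc)))

∑<-const : ∀ m c → ∑[ _ < m ] c ≡ m * c
∑<-const zero    c = refl
∑<-const (suc m) c = cong (c +_) (∑<-const m c)

∑<-truncate : ∀ {m M} (f : ℕ → ℕ) → m ≤ M → (∀ i → m ≤ i → f i ≡ 0) → ∑< M f ≡ ∑< m f
∑<-truncate {zero}  {M}     f _         f≡0 = ∑<-zero M (λ i _ → f≡0 i z≤n)
∑<-truncate {suc m} {suc M} f (s≤s m≤M) f≡0 =
  cong (f 0 +_) (∑<-truncate (f ∘ suc) m≤M (λ i m≤i → f≡0 (suc i) (s≤s m≤i)))

𝟙 : ∀ {a} {A : Set a} → Dec A → ℕ
𝟙 a? = if does a? then 1 else 0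

𝟙-yes : ∀ {a} {A : Set a} (a? : Dec A) → A → 𝟙 a? ≡ 1
𝟙-yes a? x = cong (λ b → if b then 1 else 0) (dec-true a? x)

𝟙-no : ∀ {a} {A : Set a} (a? : Dec A) → ¬ A → 𝟙 a? ≡ 0
𝟙-no a? ¬x = cong (λ b → if b then 1 else 0) (dec-false a? ¬x)

𝟙-suc≤suc : ∀ j x → 𝟙 (suc j ≤? suc x) ≡ 𝟙 (j ≤? x)
𝟙-suc≤suc j x = cong (λ b → if b then 1 else 0) (does-⇔ (mk⇔ s≤s⁻¹ s≤s) (suc j ≤? suc x) (j ≤? x))

length-filter : ∀ {a p} {A : Set a} {P : Pred A p} (P? : Decidable P) (xs : List A) →
                length (filter P? xs) ≡ sum (map (𝟙 ∘ P?) xs)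
length-filter P? []       = refl
length-filter P? (x ∷ xs) with does (P? x)
... | true  = cong suc (length-filter P? xs)
... | false = length-filter P? xs

∑<-𝟙≤ : ∀ m b → b ≤ m → ∑[ i < m ] 𝟙 (suc i ≤? b) ≡ b
∑<-𝟙≤ m       zero    _         = ∑<-zero m (λ i _ → 𝟙-no (suc i ≤? 0) λ ())
∑<-𝟙≤ (suc m) (suc b) (s≤s b≤m) = cong suc (begin
  ∑[ i < m ] 𝟙 (suc (suc i) ≤? suc b) ≡⟨ ∑<-cong m (λ i _ → 𝟙-suc≤suc (suc i) b) ⟩
  ∑[ i < m ] 𝟙 (suc i ≤? b)           ≡⟨ ∑<-𝟙≤ m b b≤m ⟩
  b                                    ∎)

∑<-suc*𝟙≤ : ∀ m b → b ≤ m → 2 * ∑[ i < m ] (suc i * 𝟙 (suc i ≤? b)) ≡ b * b + b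
∑<-suc*𝟙≤ m       zero    _         = cong (2 *_) (∑<-zero m (λ i _ →
  trans (cong (suc i *_) (𝟙-no (suc i ≤? 0) λ ())) (*-zeroʳ (suc i))))
∑<-suc*𝟙≤ (suc m) (suc b) (s≤s b≤m) = begin
  2 * (1 + ∑[ i < m ] (suc (suc i) * 𝟙 (suc (suc i) ≤? suc b)))
    ≡⟨ cong (λ t → 2 * (1 + t)) (∑<-cong m (λ i _ → cong (suc (suc i) *_) (𝟙-suc≤suc (suc i) b))) ⟩
  2 * (1 + ∑[ i < m ] (𝟙 (suc i ≤? b) + suc i * 𝟙 (suc i ≤? b)))
    ≡⟨ cong (λ t → 2 * (1 + t)) (∑<-distrib-+ m _ _) ⟩
  2 * (1 + (∑[ i < m ] 𝟙 (suc i ≤? b) + W))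
    ≡⟨ cong (λ t → 2 * (1 + (t + W))) (∑<-𝟙≤ m b b≤m) ⟩
  2 * (1 + (b + W))         ≡⟨ expand b W ⟩
  2 + 2 * b + 2 * W         ≡⟨ cong (2 + 2 * b +_) (∑<-suc*𝟙≤ m b b≤m) ⟩
  2 + 2 * b + (b * b + b)   ≡⟨ collect b ⟩
  suc b * suc b + suc b     ∎
  where
  W : ℕ
  W = ∑[ i < m ] (suc i * 𝟙 (suc i ≤? b))
  expand : ∀ b t → 2 * (1 + (b + t)) ≡ 2 + 2 * b + 2 * t
  expand = solve-∀
  collect : ∀ b → 2 + 2 * b + (b * b + b) ≡ suc b * suc b + suc b
  collect = solve-∀

Linked≥⇒All≤ : ∀ {a β} → Linked _≥_ (a ∷ β) → All (_≤ a) β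
Linked≥⇒All≤ {β = []}    _         = []
Linked≥⇒All≤ {β = _ ∷ _} (b≤a ∷ β↘) = Linked⇒All (λ y≤x z≤y → ≤-trans z≤y y≤x) b≤a β↘

All≤⇒first≤ : ∀ {a β} → All (_≤ a) β → first β ≤ a
All≤⇒first≤ []        = z≤n
All≤⇒first≤ (b≤a ∷ _) = b≤a

All≤first : ∀ {α} → Linked _≥_ α → All (_≤ first α) α
All≤first {[]}    _  = []
All≤first {a ∷ β} α↘ = ≤-refl ∷ Linked≥⇒All≤ α↘

span-tail : ∀ {a β N} → Linked _≥_ (a ∷ β) → length (a ∷ β) + a ≤ suc N → length β + first β ≤ N
span-tail {a} {β} α↘ (s≤s p) = ≤-trans (+-monoʳ-≤ (length β) (All≤⇒first≤ (Linked≥⇒All≤ α↘))) p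

countGe-∷ : ∀ j x xs → countGe j (x ∷ xs) ≡ 𝟙 (j ≤? x) + countGe j xs
countGe-∷ j x xs with does (j ≤? x)
... | true  = refl
... | false = refl

∑<-countGe : ∀ m {β} → All (_≤ m) β → ∑[ i < m ] countGe (suc i) β ≡ sum β
∑<-countGe m {[]}    _           = ∑<-zero m (λ _ _ → refl)
∑<-countGe m {b ∷ γ} (b≤m ∷ γ≤m) = begin
  ∑[ i < m ] countGe (suc i) (b ∷ γ)
    ≡⟨ ∑<-cong m (λ i _ → countGe-∷ (suc i) b γ) ⟩
  ∑[ i < m ] (𝟙 (suc i ≤? b) + countGe (suc i) γ)
    ≡⟨ ∑<-distrib-+ m _ _ ⟩
  ∑[ i < m ] 𝟙 (suc i ≤? b) + ∑[ i < m ] countGe (suc i) γ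
    ≡⟨ cong₂ _+_ (∑<-𝟙≤ m b b≤m) (∑<-countGe m γ≤m) ⟩
  b + sum γ
    ∎

countGe-beyond : ∀ {m i β} → All (_≤ m) β → m ≤ i → countGe (suc i) β ≡ 0
countGe-beyond {β = []}    _           _   = refl
countGe-beyond {i = i} {β = b ∷ γ} (b≤m ∷ γ≤m) m≤i =
  trans (countGe-∷ (suc i) b γ)
        (cong₂ _+_ (𝟙-no (suc i ≤? b) (≤⇒≯ (≤-trans b≤m m≤i))) (countGe-beyond γ≤m m≤i))

s-conj : ∀ α → s (conj α) ≡ ∑[ i < first α ] (countGe (suc i) α * countGe (suc i) α)
s-conj α = cong sum (trans
  (cong (map (λ x → x * x)) (map-applyUpTo suc (λ j → countGe j α) (first α)))
  (map-applyUpTo _ (λ x → x * x) (first α)))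

s-conj-∷ : ∀ {a β} → Linked _≥_ (a ∷ β) → s (conj (a ∷ β)) ≡ a + 2 * sum β + s (conj β)
s-conj-∷ {a} {β} α↘ = begin
  s (conj (a ∷ β))                                   ≡⟨ s-conj (a ∷ β) ⟩
  ∑[ i < a ] (countGe (suc i) (a ∷ β) * countGe (suc i) (a ∷ β))
    ≡⟨ ∑<-cong a (λ i i<a → cong (λ x → x * x) (countGe-∷-head i<a)) ⟩
  ∑[ i < a ] (suc (c i) * suc (c i))                 ≡⟨ ∑<-cong a (λ i _ → square-suc (c i)) ⟩
  ∑[ i < a ] (1 + (c i + c i) + c i * c i)          ≡⟨ ∑<-distrib-+ a _ _ ⟩
  ∑[ i < a ] (1 + (c i + c i)) + ∑[ i < a ] (c i * c i)
    ≡⟨ cong₂ _+_ (trans (∑<-distrib-+ a _ _) (cong₂ _+_ (∑<-const a 1) (∑<-distrib-+ a c c)))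
                 (∑<-truncate _ (All≤⇒first≤ β≤a) c²-beyond) ⟩
  a * 1 + (∑< a c + ∑< a c) + ∑[ i < first β ] (c i * c i)
    ≡⟨ cong₂ _+_ (cong (λ t → a * 1 + (t + t)) (∑<-countGe a β≤a)) (sym (s-conj β)) ⟩
  a * 1 + (sum β + sum β) + s (conj β)               ≡⟨ tidy a (sum β) (s (conj β)) ⟩
  a + 2 * sum β + s (conj β)                         ∎
  where
  β≤a : All (_≤ a) β
  β≤a = Linked≥⇒All≤ α↘
  c : ℕ → ℕ
  c i = countGe (suc i) β
  countGe-∷-head : ∀ {i} → i < a → countGe (suc i) (a ∷ β) ≡ suc (c i)
  countGe-∷-head {i} i<a = trans (countGe-∷ (suc i) a β) (cong (_+ c i) (𝟙-yes (suc i ≤? a) i<a))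
  c²-beyond : ∀ i → first β ≤ i → c i * c i ≡ 0
  c²-beyond i β₁≤i = cong (λ x → x * x) (countGe-beyond (All≤first (tail α↘)) β₁≤i)
  square-suc : ∀ x → suc x * suc x ≡ 1 + (x + x) + x * x
  square-suc = solve-∀
  tidy : ∀ a n t → a * 1 + (n + n) + t ≡ a + 2 * n + t
  tidy = solve-∀

-- Row i counted from 0 is the paper's row i + 1, whence α_{i+1} + (i + 1) − 1 = part α (suc i) + i.
d≡∑< : ∀ α k → d α k ≡ ∑[ i < k ] 𝟙 (k ≤? part α (suc i) + i)
d≡∑< α k = begin
  d α k                                           ≡⟨ length-filter _ (applyUpTo suc k) ⟩
  sum (map (𝟙 ∘ diagonal?) (applyUpTo suc k))     ≡⟨ cong sum (map-applyUpTo suc (𝟙 ∘ diagonal?) k) ⟩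
  ∑[ i < k ] 𝟙 (k ≤? part α (suc i) + suc i ∸ 1)
    ≡⟨ ∑<-cong k (λ i _ → cong (λ x → 𝟙 (k ≤? x ∸ 1)) (+-suc (part α (suc i)) i)) ⟩
  ∑[ i < k ] 𝟙 (k ≤? part α (suc i) + i)          ∎
  where
  diagonal? : (i : ℕ) → Dec (k ≤ part α i + i ∸ 1)
  diagonal? i = k ≤? part α i + i ∸ 1

d-[] : ∀ k → d [] k ≡ 0
d-[] k = trans (d≡∑< [] k) (∑<-zero k (λ i i<k → 𝟙-no (k ≤? i) (<⇒≱ i<k)))

d-∷ : ∀ a β k → d (a ∷ β) (suc k) ≡ 𝟙 (suc k ≤? a) + d β k
d-∷ a β k = begin
  d (a ∷ β) (suc k)                                             ≡⟨ d≡∑< (a ∷ β) (suc k) ⟩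
  𝟙 (suc k ≤? a + 0) + ∑[ i < k ] 𝟙 (suc k ≤? part β (suc i) + suc i)
    ≡⟨ cong₂ _+_ (cong (λ x → 𝟙 (suc k ≤? x)) (+-identityʳ a))
                 (∑<-cong k (λ i _ → trans (cong (λ x → 𝟙 (suc k ≤? x)) (+-suc (part β (suc i)) i))
                                           (𝟙-suc≤suc k (part β (suc i) + i)))) ⟩
  𝟙 (suc k ≤? a) + ∑[ i < k ] 𝟙 (k ≤? part β (suc i) + i)     ≡⟨ cong (𝟙 (suc k ≤? a) +_) (sym (d≡∑< β k)) ⟩
  𝟙 (suc k ≤? a) + d β k                                       ∎

d-vanishes : ∀ {α k} → Linked _≥_ α → length α + first α ≤ k → d α k ≡ 0
d-vanishes {[]}    {k}     _  _         = d-[] k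
d-vanishes {a ∷ β} {suc k} α↘ span≤1+k@(s≤s span≤k) =
  trans (d-∷ a β k) (cong₂ _+_ (𝟙-no (suc k ≤? a) (≤⇒≯ (m+n≤o⇒n≤o (length β) span≤k)))
                               (d-vanishes (tail α↘) (span-tail α↘ span≤1+k)))

∑<-d : ∀ {α} N → Linked _≥_ α → length α + first α ≤ N → ∑[ k < N ] d α (suc k) ≡ sum α
∑<-d {[]}    N       _  _        = ∑<-zero N (λ k _ → d-[] (suc k))
∑<-d {a ∷ β} (suc N) α↘ span≤1+N = begin
  ∑[ k < suc N ] d (a ∷ β) (suc k)                    ≡⟨ ∑<-cong (suc N) (λ k _ → d-∷ a β k) ⟩
  ∑[ k < suc N ] (𝟙 (suc k ≤? a) + d β k)             ≡⟨ ∑<-distrib-+ (suc N) (λ k → 𝟙 (suc k ≤? a)) (d β) ⟩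
  ∑[ k < suc N ] 𝟙 (suc k ≤? a) + ∑[ k < N ] d β (suc k)
    ≡⟨ cong₂ _+_ (∑<-𝟙≤ (suc N) a (m+n≤o⇒n≤o (length (a ∷ β)) span≤1+N))
                 (∑<-d N (tail α↘) (span-tail α↘ span≤1+N)) ⟩
  a + sum β                                           ∎

weightedDiagSum≡∑< : ∀ α N → weightedDiagSum α N ≡ ∑[ k < N ] (suc k * d α (suc k))
weightedDiagSum≡∑< α N = cong sum (map-applyUpTo suc (λ k → k * d α k) N)

weightedDiagSum-cong : ∀ {α β} N → (∀ k → 1 ≤ k → d α k ≡ d β k) →
                       weightedDiagSum α N ≡ weightedDiagSum β N
weightedDiagSum-cong {α} {β} N dα≡dβ = begin
  weightedDiagSum α N                  ≡⟨ weightedDiagSum≡∑< α N ⟩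
  ∑[ k < N ] (suc k * d α (suc k))     ≡⟨ ∑<-cong N (λ k _ → cong (suc k *_) (dα≡dβ (suc k) (s≤s z≤n))) ⟩
  ∑[ k < N ] (suc k * d β (suc k))     ≡⟨ sym (weightedDiagSum≡∑< β N) ⟩
  weightedDiagSum β N                  ∎

weightedDiagSum-[] : ∀ N → weightedDiagSum [] N ≡ 0
weightedDiagSum-[] N = trans (weightedDiagSum≡∑< [] N)
  (∑<-zero N (λ k _ → trans (cong (suc k *_) (d-[] (suc k))) (*-zeroʳ (suc k))))

weightedDiagSum-∷ : ∀ {a β N} → Linked _≥_ (a ∷ β) → length (a ∷ β) + a ≤ suc N →
                    2 * weightedDiagSum (a ∷ β) (suc N) ≡ a * a + a + 2 * sum β + 2 * weightedDiagSum β N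
weightedDiagSum-∷ {a} {β} {N} α↘ span≤1+N = begin
  2 * weightedDiagSum (a ∷ β) (suc N)
    ≡⟨ cong (2 *_) (weightedDiagSum≡∑< (a ∷ β) (suc N)) ⟩
  2 * ∑[ k < suc N ] (suc k * d (a ∷ β) (suc k))
    ≡⟨ cong (2 *_) (∑<-cong (suc N) (λ k _ → trans (cong (suc k *_) (d-∷ a β k))
                                                    (*-distribˡ-+ (suc k) (𝟙 (suc k ≤? a)) (d β k)))) ⟩
  2 * ∑[ k < suc N ] (suc k * 𝟙 (suc k ≤? a) + suc k * d β k)
    ≡⟨ cong (2 *_) (∑<-distrib-+ (suc N) (λ k → suc k * 𝟙 (suc k ≤? a)) (λ k → suc k * d β k)) ⟩
  2 * (T + ∑[ k < N ] (d β (suc k) + suc k * d β (suc k)))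
    ≡⟨ cong (λ t → 2 * (T + t)) (∑<-distrib-+ N (λ k → d β (suc k)) (λ k → suc k * d β (suc k))) ⟩
  2 * (T + (∑[ k < N ] d β (suc k) + W))
    ≡⟨ cong (λ t → 2 * (T + (t + W))) (∑<-d N (tail α↘) (span-tail α↘ span≤1+N)) ⟩
  2 * (T + (sum β + W))
    ≡⟨ expand T (sum β) W ⟩
  2 * T + 2 * sum β + 2 * W
    ≡⟨ cong (λ t → t + 2 * sum β + 2 * W) (∑<-suc*𝟙≤ (suc N) a (m+n≤o⇒n≤o (length (a ∷ β)) span≤1+N)) ⟩
  a * a + a + 2 * sum β + 2 * W
    ≡⟨ cong (λ t → a * a + a + 2 * sum β + 2 * t) (sym (weightedDiagSum≡∑< β N)) ⟩
  a * a + a + 2 * sum β + 2 * weightedDiagSum β N ∎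
  where
  T W : ℕ
  T = ∑[ k < suc N ] (suc k * 𝟙 (suc k ≤? a))
  W = ∑[ k < N ] (suc k * d β (suc k))
  expand : ∀ x y z → 2 * (x + (y + z)) ≡ 2 * x + 2 * y + 2 * z
  expand = solve-∀

s+s-conj≡2*weightedDiagSum : ∀ {α} N → Linked _≥_ α → length α + first α ≤ N →
                             s α + s (conj α) ≡ 2 * weightedDiagSum α N
s+s-conj≡2*weightedDiagSum {[]}    N       _  _        = sym (cong (2 *_) (weightedDiagSum-[] N))
s+s-conj≡2*weightedDiagSum {a ∷ β} (suc N) α↘ span≤1+N = begin
  a * a + s β + s (conj (a ∷ β))                  ≡⟨ cong (a * a + s β +_) (s-conj-∷ α↘) ⟩
  a * a + s β + (a + 2 * sum β + s (conj β))      ≡⟨ regroup (a * a) (s β) a (2 * sum β) (s (conj β)) ⟩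
  a * a + a + 2 * sum β + (s β + s (conj β))
    ≡⟨ cong (a * a + a + 2 * sum β +_)
            (s+s-conj≡2*weightedDiagSum N (tail α↘) (span-tail α↘ span≤1+N)) ⟩
  a * a + a + 2 * sum β + 2 * weightedDiagSum β N ≡⟨ sym (weightedDiagSum-∷ α↘ span≤1+N) ⟩
  2 * weightedDiagSum (a ∷ β) (suc N)             ∎
  where
  regroup : ∀ x y z u v → x + y + (z + u + v) ≡ x + z + u + (y + v)
  regroup = solve-∀

proposition2p9 : ((n : ℕ) (α : List ℕ) → IsPartition n α →
    ((k : ℕ) → length α + first α ≤ k → d α k ≡ 0)
    × ((N : ℕ) → length α + first α ≤ N →
    s α + s (conj α) ≡ 2 * weightedDiagSum α N))
    × ((n : ℕ) (α β : List ℕ) → IsPartition n α → IsPartition n β →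
    ((k : ℕ) → 1 ≤ k → d α k ≡ d β k) →
    s α + s (conj α) ≡ s β + s (conj β))
proposition2p9 =
  (λ n α (α↘ , _) → (λ k → d-vanishes α↘) , (λ N → s+s-conj≡2*weightedDiagSum N α↘)) ,
  λ n α β (α↘ , _) (β↘ , _) dα≡dβ →
    let Nα = length α + first α; Nβ = length β + first β; N = Nα + Nβ in begin
      s α + s (conj α)        ≡⟨ s+s-conj≡2*weightedDiagSum N α↘ (m≤m+n Nα Nβ) ⟩
      2 * weightedDiagSum α N ≡⟨ cong (2 *_) (weightedDiagSum-cong {α} {β} N dα≡dβ) ⟩
      2 * weightedDiagSum β N ≡⟨ sym (s+s-conj≡2*weightedDiagSum N β↘ (m≤n+m Nβ Nα)) ⟩
      s β + s (conj β)        ∎
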